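{- Let $\mathbf{C}$ be an $r$-regular category, let $f:Y\to X$ and $Z$ be given, and consider the pullback square formed by $f\times 1_Z:Y\times Z\to X\times Z$, the projections $\pi_Y:Y\times Z\to Y$, $\pi_X:X\times Z\to X$, and $f$. If $S\in\mathsf{Sub}_r(X\times Z)$ and $B_1,\dots,B_n\in\mathsf{Sub}_r(X)$ is a $\forall_Z$-factorization of $S$, then $f^{ -1}(B_1),\dots,f^{ -1}(B_n)$ is a $\forall_Z$-factorization of $(f\times 1)^{ -1}(S)$.
   Context: A category is $r$-regular if it has all finite limits, epimorphisms are stable under pullback, and every arrow factors as an epimorphism followed by a regular monomorphism. $\mathsf{Sub}_r(X)$ is the poset of regular subobjects of $X$; for $f:Y\to X$, $f^{ -1}:\mathsf{Sub}_r(X)\to\mathsf{Sub}_r(Y)$ is pullback along $f$. Given $S\in\mathsf{Sub}_r(X\times Z)$, regular subobjects $B_1,\dots,B_n\in\mathsf{Sub}_r(X)$ form a $\forall_Z$-factorization of $S$ if (1) $\pi_X^{ -1}(B_i)\le S$ for each $i$, and (2) for every $C\in\mathsf{Sub}_r(X)$ with $\pi_X^{ -1}(C)\le S$ there is some $i$ with $C\le B_i$. -}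

module Defs where

open import Level using (Level; _⊔_; suc)
open import Data.Product using (Σ; _×_; _,_; proj₁; proj₂)
open import Data.Fin using (Fin)
open import Data.Nat using (ℕ)
open import Relation.Binary using (IsEquivalence)

record Category (o ℓ e : Level) : Set (suc (o ⊔ ℓ ⊔ e)) where
  infix  4 _≈_
  infixr 9 _∘_
  field
    Obj   : Set o
    _⇒_   : Obj → Obj → Set ℓ
    _≈_   : ∀ {A B} → A ⇒ B → A ⇒ B → Set e
    id    : ∀ {A} → A ⇒ A
    _∘_   : ∀ {A B C} → B ⇒ C → A ⇒ B → A ⇒ C
    ≈-equiv : ∀ {A B} → IsEquivalence (_≈_ {A} {B})
    ∘-resp-≈ : ∀ {A B C} {f h : B ⇒ C} {g i : A ⇒ B} → f ≈ h → g ≈ i → f ∘ g ≈ h ∘ i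
    assoc : ∀ {A B C D} {f : A ⇒ B} {g : B ⇒ C} {h : C ⇒ D} → (h ∘ g) ∘ f ≈ h ∘ (g ∘ f)
    identityˡ : ∀ {A B} {f : A ⇒ B} → id ∘ f ≈ f
    identityʳ : ∀ {A B} {f : A ⇒ B} → f ∘ id ≈ f

module _ {o ℓ e : Level} (𝒞 : Category o ℓ e) where
  open Category 𝒞

  Epi : ∀ {A B} → A ⇒ B → Set (o ⊔ ℓ ⊔ e)
  Epi {A} {B} f = ∀ {C} (g h : B ⇒ C) → g ∘ f ≈ h ∘ f → g ≈ h

  Mono : ∀ {A B} → A ⇒ B → Set (o ⊔ ℓ ⊔ e)
  Mono {A} {B} f = ∀ {C} (g h : C ⇒ A) → f ∘ g ≈ f ∘ h → g ≈ h

  record IsTerminal (T : Obj) : Set (o ⊔ ℓ ⊔ e) where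
    field
      ! : ∀ {A} → A ⇒ T
      !-unique : ∀ {A} (f g : A ⇒ T) → f ≈ g

  record Terminal : Set (o ⊔ ℓ ⊔ e) where
    field
      ⊤ : Obj
      isTerminal : IsTerminal ⊤

  record IsProduct {A B P : Obj} (p₁ : P ⇒ A) (p₂ : P ⇒ B) : Set (o ⊔ ℓ ⊔ e) where
    field
      pair : ∀ {Q} (h₁ : Q ⇒ A) (h₂ : Q ⇒ B) → Σ (Q ⇒ P) λ u → (p₁ ∘ u ≈ h₁) × (p₂ ∘ u ≈ h₂)
      unique : ∀ {Q} (u v : Q ⇒ P) → p₁ ∘ u ≈ p₁ ∘ v → p₂ ∘ u ≈ p₂ ∘ v → u ≈ v

  record Product (A B : Obj) : Set (o ⊔ ℓ ⊔ e) where
    field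
      A×B : Obj
      π₁ : A×B ⇒ A
      π₂ : A×B ⇒ B
      isProduct : IsProduct π₁ π₂

  record IsPullback {P A B C : Obj} (f : A ⇒ C) (g : B ⇒ C) (p₁ : P ⇒ A) (p₂ : P ⇒ B)
         : Set (o ⊔ ℓ ⊔ e) where
    field
      commute : f ∘ p₁ ≈ g ∘ p₂
      universal : ∀ {Q} (h₁ : Q ⇒ A) (h₂ : Q ⇒ B) → f ∘ h₁ ≈ g ∘ h₂ →
                  Σ (Q ⇒ P) λ u → (p₁ ∘ u ≈ h₁) × (p₂ ∘ u ≈ h₂)
      unique : ∀ {Q} (u v : Q ⇒ P) → p₁ ∘ u ≈ p₁ ∘ v → p₂ ∘ u ≈ p₂ ∘ v → u ≈ v

  record Pullback {A B C : Obj} (f : A ⇒ C) (g : B ⇒ C) : Set (o ⊔ ℓ ⊔ e) where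
    field
      P : Obj
      p₁ : P ⇒ A
      p₂ : P ⇒ B
      isPullback : IsPullback f g p₁ p₂

  record IsEqualizer {E A B : Obj} (m : E ⇒ A) (f g : A ⇒ B) : Set (o ⊔ ℓ ⊔ e) where
    field
      equality : f ∘ m ≈ g ∘ m
      universal : ∀ {Q} (h : Q ⇒ A) → f ∘ h ≈ g ∘ h → Σ (Q ⇒ E) λ u → m ∘ u ≈ h
      unique : ∀ {Q} (u v : Q ⇒ E) → m ∘ u ≈ m ∘ v → u ≈ v

  record Equalizer {A B : Obj} (f g : A ⇒ B) : Set (o ⊔ ℓ ⊔ e) where
    field
      E : Obj
      m : E ⇒ A
      isEqualizer : IsEqualizer m f g

  IsRegularMono : ∀ {E A} → E ⇒ A → Set (o ⊔ ℓ ⊔ e)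
  IsRegularMono {E} {A} m = Σ Obj λ B → Σ (A ⇒ B) λ f → Σ (A ⇒ B) λ g → IsEqualizer m f g

  record IsRRegular : Set (o ⊔ ℓ ⊔ e) where
    field
      terminal  : Terminal
      product   : ∀ A B → Product A B
      pullback  : ∀ {A B C} (f : A ⇒ C) (g : B ⇒ C) → Pullback f g
      equalizer : ∀ {A B} (f g : A ⇒ B) → Equalizer f g
      epi-stable : ∀ {P A B C} {f : A ⇒ C} {g : B ⇒ C} {p₁ : P ⇒ A} {p₂ : P ⇒ B} →
                   IsPullback f g p₁ p₂ → Epi f → Epi p₂
      factorize : ∀ {A B} (f : A ⇒ B) →
                  Σ Obj λ I → Σ (A ⇒ I) λ q → Σ (I ⇒ B) λ m →
                    Epi q × IsRegularMono m × (m ∘ q ≈ f)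

  record SubR (X : Obj) : Set (o ⊔ ℓ ⊔ e) where
    constructor subR
    field
      dom : Obj
      arr : dom ⇒ X
      regular : IsRegularMono arr

  _≤ₘ_ : ∀ {X A B} → A ⇒ X → B ⇒ X → Set (ℓ ⊔ e)
  _≤ₘ_ {X} {A} {B} m n = Σ (A ⇒ B) λ k → n ∘ k ≈ m

  -- B' is (a representative of) the pullback g⁻¹(B) of B along g
  IsPullbackOf : ∀ {W X} (g : W ⇒ X) → SubR X → SubR W → Set (o ⊔ ℓ ⊔ e)
  IsPullbackOf g B B' = Σ (SubR.dom B' ⇒ SubR.dom B) λ k → IsPullback (SubR.arr B) g k (SubR.arr B')

  module RRegularOps (R : IsRRegular) where
    open IsRRegular R

    _×ₒ_ : Obj → Obj → Obj
    A ×ₒ B = Product.A×B (product A B)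

    πˡ : ∀ {A B} → (A ×ₒ B) ⇒ A
    πˡ {A} {B} = Product.π₁ (product A B)

    πʳ : ∀ {A B} → (A ×ₒ B) ⇒ B
    πʳ {A} {B} = Product.π₂ (product A B)

    _×id : ∀ {Y X Z} → Y ⇒ X → (Y ×ₒ Z) ⇒ (X ×ₒ Z)
    _×id {Y} {X} {Z} f = proj₁ (IsProduct.pair (Product.isProduct (product X Z)) (f ∘ πˡ) πʳ)

    -- g⁻¹(B) ≤ S, with g⁻¹(B) computed by the chosen pullback
    PreimageLe : ∀ {W X} (g : W ⇒ X) → SubR X → SubR W → Set (ℓ ⊔ e)
    PreimageLe g B S = Pullback.p₂ (pullback (SubR.arr B) g) ≤ₘ SubR.arr S

    IsForallFactorization : ∀ {X Z} (S : SubR (X ×ₒ Z)) {n : ℕ} (B : Fin n → SubR X) → Set (o ⊔ ℓ ⊔ e)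
    IsForallFactorization {X} {Z} S {n} B =
      (∀ i → PreimageLe (πˡ {X} {Z}) (B i) S) ×
      (∀ (C : SubR X) → PreimageLe (πˡ {X} {Z}) C S → Σ (Fin n) λ i → SubR.arr C ≤ₘ SubR.arr (B i))

-- Pulling back along f commutes with π_X⁻¹, because the square formed by f × 1 and
-- the two projections is a pullback.  Hence the first condition of a ∀_Z-factorization
-- transfers directly.  For the second, a C ≤ Y with π_Y⁻¹(C) ≤ (f × 1)⁻¹(S) is pushed
-- forward to the image D of f ∘ C; π_X⁻¹(D) is covered, through the pullback-stable
-- epi onto the image, by something that f × 1 maps into S, so π_X⁻¹(D) ≤ S because
-- regular monos are orthogonal to epis.  Thus D ≤ Bᵢ for some i, i.e. C ≤ f⁻¹(Bᵢ).
module Submission where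

open import Defs
open import Level using (Level; _⊔_)
open import Data.Nat using (ℕ)
open import Data.Fin using (Fin)
open import Data.Product using (Σ; _×_; _,_; proj₁; proj₂)
open import Relation.Binary using (Setoid; IsEquivalence)
import Relation.Binary.Reasoning.Setoid as SetoidReasoning

module SubobjectOrder {o ℓ e : Level} (𝒞 : Category o ℓ e) where
  open Category 𝒞

  hom-setoid : Obj → Obj → Setoid ℓ e
  hom-setoid A B = record { Carrier = A ⇒ B ; _≈_ = _≈_ ; isEquivalence = ≈-equiv }

  module HomReasoning {A B : Obj} = SetoidReasoning (hom-setoid A B)
  module Equiv {A B : Obj} = IsEquivalence (≈-equiv {A} {B})
  open HomReasoning

  infix 4 _≤_
  _≤_ : ∀ {X A B} → A ⇒ X → B ⇒ X → Set (ℓ ⊔ e)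
  _≤_ = _≤ₘ_ 𝒞

  ∘-resp-≈ˡ : ∀ {A B C} {f h : B ⇒ C} {g : A ⇒ B} → f ≈ h → f ∘ g ≈ h ∘ g
  ∘-resp-≈ˡ f≈h = ∘-resp-≈ f≈h Equiv.refl

  ∘-resp-≈ʳ : ∀ {A B C} {f : B ⇒ C} {g i : A ⇒ B} → g ≈ i → f ∘ g ≈ f ∘ i
  ∘-resp-≈ʳ g≈i = ∘-resp-≈ Equiv.refl g≈i

  sym-assoc : ∀ {A B C D} {f : A ⇒ B} {g : B ⇒ C} {h : C ⇒ D} → h ∘ (g ∘ f) ≈ (h ∘ g) ∘ f
  sym-assoc = Equiv.sym assoc

  extendʳ : ∀ {A B C D E} {a : B ⇒ E} {b : A ⇒ B} {c : D ⇒ E} {d : A ⇒ D} {h : C ⇒ A} →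
            a ∘ b ≈ c ∘ d → a ∘ (b ∘ h) ≈ c ∘ (d ∘ h)
  extendʳ {a = a} {b} {c} {d} {h} sq = begin
    a ∘ (b ∘ h)  ≈⟨ sym-assoc ⟩
    (a ∘ b) ∘ h  ≈⟨ ∘-resp-≈ˡ sq ⟩
    (c ∘ d) ∘ h  ≈⟨ assoc ⟩
    c ∘ (d ∘ h)  ∎

  ≤-trans : ∀ {X A B C} {a : A ⇒ X} {b : B ⇒ X} {c : C ⇒ X} → a ≤ b → b ≤ c → a ≤ c
  ≤-trans {a = a} {b} {c} (k , bk≈a) (l , cl≈b) = l ∘ k , (begin
    c ∘ (l ∘ k)  ≈⟨ sym-assoc ⟩
    (c ∘ l) ∘ k  ≈⟨ ∘-resp-≈ˡ cl≈b ⟩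
    b ∘ k        ≈⟨ bk≈a ⟩
    a            ∎)

  ≤-respˡ : ∀ {X A B} {a a′ : A ⇒ X} {b : B ⇒ X} → a ≈ a′ → a ≤ b → a′ ≤ b
  ≤-respˡ a≈a′ (k , bk≈a) = k , Equiv.trans bk≈a a≈a′

  ≤-∘ʳ : ∀ {X A B W} {a : A ⇒ X} {b : B ⇒ X} (h : W ⇒ A) → a ≤ b → a ∘ h ≤ b
  ≤-∘ʳ h (k , bk≈a) = k ∘ h , Equiv.trans sym-assoc (∘-resp-≈ˡ bk≈a)

  module _ {B W X B′ : Obj} {b : B ⇒ X} {g : W ⇒ X} {k : B′ ⇒ B} {b′ : B′ ⇒ W}
           (pb : IsPullback 𝒞 b g k b′) where
    open IsPullback pb

    ≤-pullback⁺ : ∀ {Q} {h : Q ⇒ W} → g ∘ h ≤ b → h ≤ b′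
    ≤-pullback⁺ {h = h} (x , bx≈gh) with universal x h bx≈gh
    ... | u , _ , b′u≈h = u , b′u≈h

    ≤-pullback⁻ : ∀ {Q} {h : Q ⇒ W} → h ≤ b′ → g ∘ h ≤ b
    ≤-pullback⁻ (l , b′l≈h) =
      k ∘ l , Equiv.trans (extendʳ commute) (∘-resp-≈ʳ b′l≈h)

  -- a ∘ r and b ∘ r agree after the epi w, hence agree, so r factors through the equalizer m of a, b.
  ≤-epi-cancel : ∀ {X E V W} {m : E ⇒ X} {r : V ⇒ X} {w : W ⇒ V} →
                 IsRegularMono 𝒞 m → Epi 𝒞 w → r ∘ w ≤ m → r ≤ m
  ≤-epi-cancel {m = m} {r} {w} (_ , a , b , eq) w-epi (k , mk≈rw) =
    universal r (w-epi (a ∘ r) (b ∘ r) ar∘w≈br∘w)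
    where
    open IsEqualizer eq
    ar∘w≈br∘w : (a ∘ r) ∘ w ≈ (b ∘ r) ∘ w
    ar∘w≈br∘w = begin
      (a ∘ r) ∘ w  ≈⟨ assoc ⟩
      a ∘ (r ∘ w)  ≈⟨ ∘-resp-≈ʳ mk≈rw ⟨
      a ∘ (m ∘ k)  ≈⟨ extendʳ equality ⟩
      b ∘ (m ∘ k)  ≈⟨ ∘-resp-≈ʳ mk≈rw ⟩
      b ∘ (r ∘ w)  ≈⟨ sym-assoc ⟩
      (b ∘ r) ∘ w  ∎

module PullbackStability {o ℓ e : Level} {𝒞 : Category o ℓ e} (R : IsRRegular 𝒞) where
  open Category 𝒞
  open IsRRegular R
  open RRegularOps 𝒞 R
  open SubobjectOrder 𝒞
  open HomReasoning
  open SubR using (arr)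

  PreimageLe-≤ : ∀ {W X Q} {g : W ⇒ X} {B : SubR 𝒞 X} {S : SubR 𝒞 W} {h : Q ⇒ W} →
                 PreimageLe g B S → g ∘ h ≤ arr B → h ≤ arr S
  PreimageLe-≤ {g = g} {B} le gh≤B =
    ≤-trans (≤-pullback⁺ (Pullback.isPullback (pullback (arr B) g)) gh≤B) le

  ×id-isPullback : ∀ {X Y Z} (f : Y ⇒ X) →
                   IsPullback 𝒞 (πˡ {X} {Z}) f (_×id {Y} {X} {Z} f) (πˡ {Y} {Z})
  ×id-isPullback {X} {Y} {Z} f = record
    { commute   = πˡ∘f×id
    ; universal = universal
    ; unique    = λ u v f×id∘u≈f×id∘v πˡu≈πˡv →
        IsProduct.unique prodY u v πˡu≈πˡv (πʳ-equal f×id∘u≈f×id∘v)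
    }
    where
    prodX = Product.isProduct (product X Z)
    prodY = Product.isProduct (product Y Z)
    f×id = _×id {Y} {X} {Z} f

    πˡ∘f×id : πˡ ∘ f×id ≈ f ∘ πˡ
    πˡ∘f×id = proj₁ (proj₂ (IsProduct.pair prodX (f ∘ πˡ) πʳ))

    πʳ∘f×id : πʳ ∘ f×id ≈ πʳ
    πʳ∘f×id = proj₂ (proj₂ (IsProduct.pair prodX (f ∘ πˡ) πʳ))

    πʳ-equal : ∀ {Q} {u v : Q ⇒ (Y ×ₒ Z)} → f×id ∘ u ≈ f×id ∘ v → πʳ ∘ u ≈ πʳ ∘ v
    πʳ-equal {u = u} {v} eq = begin
      πʳ ∘ u           ≈⟨ ∘-resp-≈ˡ πʳ∘f×id ⟨
      (πʳ ∘ f×id) ∘ u  ≈⟨ assoc ⟩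
      πʳ ∘ (f×id ∘ u)  ≈⟨ ∘-resp-≈ʳ eq ⟩
      πʳ ∘ (f×id ∘ v)  ≈⟨ sym-assoc ⟩
      (πʳ ∘ f×id) ∘ v  ≈⟨ ∘-resp-≈ˡ πʳ∘f×id ⟩
      πʳ ∘ v           ∎

    universal : ∀ {Q} (h₁ : Q ⇒ (X ×ₒ Z)) (h₂ : Q ⇒ Y) → πˡ ∘ h₁ ≈ f ∘ h₂ →
                Σ (Q ⇒ (Y ×ₒ Z)) λ u → (f×id ∘ u ≈ h₁) × (πˡ ∘ u ≈ h₂)
    universal h₁ h₂ πˡh₁≈fh₂ with IsProduct.pair prodY h₂ (πʳ ∘ h₁)
    ... | u , πˡu≈h₂ , πʳu≈πʳh₁ = u , f×id∘u≈h₁ , πˡu≈h₂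
      where
      f×id∘u≈h₁ : f×id ∘ u ≈ h₁
      f×id∘u≈h₁ = IsProduct.unique prodX (f×id ∘ u) h₁
        (begin
          πˡ ∘ (f×id ∘ u)  ≈⟨ extendʳ πˡ∘f×id ⟩
          f ∘ (πˡ ∘ u)     ≈⟨ ∘-resp-≈ʳ πˡu≈h₂ ⟩
          f ∘ h₂           ≈⟨ πˡh₁≈fh₂ ⟨
          πˡ ∘ h₁          ∎)
        (begin
          πʳ ∘ (f×id ∘ u)  ≈⟨ sym-assoc ⟩
          (πʳ ∘ f×id) ∘ u  ≈⟨ ∘-resp-≈ˡ πʳ∘f×id ⟩
          πʳ ∘ u           ≈⟨ πʳu≈πʳh₁ ⟩
          πʳ ∘ h₁          ∎)

  module _ {A A′ X Y : Obj} {p : A ⇒ X} {f : Y ⇒ X} {f′ : A′ ⇒ A} {p′ : A′ ⇒ Y}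
           (square : IsPullback 𝒞 p f f′ p′)
           {S : SubR 𝒞 A} {T : SubR 𝒞 A′} (T≡f′⁻¹S : IsPullbackOf 𝒞 f′ S T) where

    PreimageLe-pullback : ∀ {B : SubR 𝒞 X} {B′ : SubR 𝒞 Y} → IsPullbackOf 𝒞 f B B′ →
                          PreimageLe p B S → PreimageLe p′ B′ T
    PreimageLe-pullback {B} {B′} B′≡f⁻¹B p⁻¹B≤S =
      ≤-pullback⁺ (proj₂ T≡f′⁻¹S) (PreimageLe-≤ {g = p} {B} {S} p⁻¹B≤S p∘f′∘q₂≤B)
      where
      open Pullback (pullback (arr B′) p′) using (isPullback) renaming (p₁ to q₁; p₂ to q₂)

      p∘f′∘q₂≤B : p ∘ (f′ ∘ q₂) ≤ arr B
      p∘f′∘q₂≤B = ≤-respˡ (Equiv.sym (extendʳ (IsPullback.commute square)))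
        (≤-pullback⁻ (proj₂ B′≡f⁻¹B) (q₁ , IsPullback.commute isPullback))

    PreimageLe-image : ∀ {C : SubR 𝒞 Y} {D : SubR 𝒞 X} {q : SubR.dom C ⇒ SubR.dom D} →
                       Epi 𝒞 q → arr D ∘ q ≈ f ∘ arr C →
                       PreimageLe p′ C T → PreimageLe p D S
    PreimageLe-image {C} {D} {q} q-epi d∘q≈f∘c p′⁻¹C≤T =
      ≤-epi-cancel (SubR.regular S) w₂-epi (≤-respˡ f′g≈r₂w₂ (≤-pullback⁻ (proj₂ T≡f′⁻¹S) g≤T))
      where
      open Pullback (pullback (arr D) p) using () renaming (p₁ to r₁; p₂ to r₂; isPullback to r-pb)
      open Pullback (pullback q r₁) using () renaming (P to W; p₁ to w₁; p₂ to w₂; isPullback to w-pb)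

      w₂-epi : Epi 𝒞 w₂
      w₂-epi = epi-stable w-pb q-epi

      p∘r₂w₂≈f∘cw₁ : p ∘ (r₂ ∘ w₂) ≈ f ∘ (arr C ∘ w₁)
      p∘r₂w₂≈f∘cw₁ = begin
        p ∘ (r₂ ∘ w₂)      ≈⟨ extendʳ (IsPullback.commute r-pb) ⟨
        arr D ∘ (r₁ ∘ w₂)  ≈⟨ ∘-resp-≈ʳ (IsPullback.commute w-pb) ⟨
        arr D ∘ (q ∘ w₁)   ≈⟨ extendʳ d∘q≈f∘c ⟩
        f ∘ (arr C ∘ w₁)   ∎

      lift : Σ (W ⇒ A′) λ g → (f′ ∘ g ≈ r₂ ∘ w₂) × (p′ ∘ g ≈ arr C ∘ w₁)
      lift = IsPullback.universal square (r₂ ∘ w₂) (arr C ∘ w₁) p∘r₂w₂≈f∘cw₁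

      g : W ⇒ A′
      g = proj₁ lift

      f′g≈r₂w₂ : f′ ∘ g ≈ r₂ ∘ w₂
      f′g≈r₂w₂ = proj₁ (proj₂ lift)

      g≤T : g ≤ arr T
      g≤T = PreimageLe-≤ {g = p′} {C} {T} p′⁻¹C≤T (w₁ , Equiv.sym (proj₂ (proj₂ lift)))

lemma5p2 : ∀ {o ℓ e : Level} (𝒞 : Category o ℓ e) (R : IsRRegular 𝒞)
    {X Y Z : Category.Obj 𝒞} (f : Category._⇒_ 𝒞 Y X)
    (S : SubR 𝒞 (RRegularOps._×ₒ_ 𝒞 R X Z)) {n : ℕ} (B : Fin n → SubR 𝒞 X) →
    RRegularOps.IsForallFactorization 𝒞 R S B →
    (T : SubR 𝒞 (RRegularOps._×ₒ_ 𝒞 R Y Z)) →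
    IsPullbackOf 𝒞 (RRegularOps._×id 𝒞 R {Y} {X} {Z} f) S T →
    (B′ : Fin n → SubR 𝒞 Y) → (∀ i → IsPullbackOf 𝒞 f (B i) (B′ i)) →
    RRegularOps.IsForallFactorization 𝒞 R T B′
lemma5p2 𝒞 R f S B (π⁻¹B≤S , maximal) T T≡f×id⁻¹S B′ B′≡f⁻¹B =
  (λ i → PreimageLe-pullback square {S} {T} T≡f×id⁻¹S {B i} {B′ i} (B′≡f⁻¹B i) (π⁻¹B≤S i)) , lower
  where
  open Category 𝒞
  open SubobjectOrder 𝒞
  open PullbackStability R
  open IsRRegular R using (factorize)
  open RRegularOps 𝒞 R using (πˡ; PreimageLe)

  square = ×id-isPullback f

  lower : ∀ C → PreimageLe πˡ C T → Σ (Fin _) λ i → SubR.arr C ≤ SubR.arr (B′ i)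
  lower C π⁻¹C≤T with factorize (f ∘ SubR.arr C)
  ... | I , q , m , q-epi , m-regular , m∘q≈f∘c
      with maximal (subR I m m-regular) (PreimageLe-image square {S} {T} T≡f×id⁻¹S {C} {subR I m m-regular} q-epi m∘q≈f∘c π⁻¹C≤T)
  ... | i , m≤Bᵢ = i , ≤-pullback⁺ (proj₂ (B′≡f⁻¹B i)) (≤-respˡ m∘q≈f∘c (≤-∘ʳ q m≤Bᵢ))
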